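{- Let $q$ be a prime power and $a,b,d,u$ integers with $2\le d\le\min\{a,b\}$ and $0\le u$. Then $\Lambda(q,a,b,d,u)\le\Lambda(q,a,b-1,d-1,u)$ and $$\Lambda(q,a,b,d,u)\le\sum_{r=0}^{\min\{u,\min\{a,b\}-d+1\}}q^{\binom r2}(q-1)^r[r]_q!\binom{\min\{a,b\}-d+1}{r}_q\binom{\max\{a,b\}}{r}_q.$$
   Context: $\Lambda(q,a,b,d,u)$ is the maximum size of a set of $a\times b$ matrices over $\mathbb{F}_q$ such that any two distinct elements $X,Y$ satisfy $\mathrm{rk}(X-Y)\ge d$ and every element has rank at most $u$. $[n]_q=(q^n-1)/(q-1)$, $[r]_q!=\prod_{i=1}^r[i]_q$ (with $[0]_q!=1$), and $\binom{n}{k}_q=\prod_{i=0}^{k-1}\frac{q^n-q^i}{q^k-q^i}$. -}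

module Defs where

open import Level using (0ℓ)
open import Data.Nat using (ℕ; zero; suc; _≤_)
import Data.Nat as Nat
open import Data.Nat.Primality using (Prime)
open import Data.Fin using (Fin)
open import Data.Product using (Σ; _×_; ∃)
open import Relation.Nullary using (¬_)
open import Relation.Binary.PropositionalEquality using (_≡_; _≢_)
open import Algebra.Bundles using (CommutativeRing)

IsPrimePower : ℕ → Set
IsPrimePower q = Σ ℕ λ p → Σ ℕ λ k → Prime p × (1 ≤ k) × (q ≡ p Nat.^ k)

record FiniteField (q : ℕ) : Set₁ where
  field
    commRing : CommutativeRing 0ℓ 0ℓ
  open CommutativeRing commRing public
  field
    0≉1     : ¬ (0# ≈ 1#)
    inverse : ∀ x → ¬ (x ≈ 0#) → Σ Carrier λ y → (x * y) ≈ 1#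
    enum      : Fin q → Carrier
    enum-inj  : ∀ i j → enum i ≈ enum j → i ≡ j
    enum-surj : ∀ x → Σ (Fin q) λ i → enum i ≈ x

module _ {q : ℕ} (F : FiniteField q) where
  open FiniteField F

  -- a × b matrices over F (a rows, b columns)
  Mat : ℕ → ℕ → Set
  Mat a b = Fin a → Fin b → Carrier

  _≈M_ : ∀ {a b} → Mat a b → Mat a b → Set
  M ≈M N = ∀ i j → M i j ≈ N i j

  _-M_ : ∀ {a b} → Mat a b → Mat a b → Mat a b
  (M -M N) i j = M i j + (- N i j)

  ΣF : ∀ {k} → (Fin k → Carrier) → Carrier
  ΣF {zero}  f = 0#
  ΣF {suc k} f = f Fin.zero + ΣF (λ i → f (Fin.suc i))

  LinIndep : ∀ {a k} → (Fin k → Fin a → Carrier) → Set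
  LinIndep {a} {k} v =
    (c : Fin k → Carrier) →
    (∀ row → ΣF (λ i → c i * v i row) ≈ 0#) →
    ∀ i → c i ≈ 0#

  RankGE : ∀ {a b} → ℕ → Mat a b → Set
  RankGE {a} {b} r M = Σ (Fin r → Fin b) λ σ → LinIndep (λ i row → M row (σ i))

  RankLE : ∀ {a b} → ℕ → Mat a b → Set
  RankLE u M = ¬ RankGE (suc u) M

  IsCode : (a b d u N : ℕ) → (Fin N → Mat a b) → Set
  IsCode a b d u N C =
    (∀ i j → C i ≈M C j → i ≡ j) ×
    (∀ i j → i ≢ j → RankGE d (C i -M C j)) ×
    (∀ i → RankLE u (C i))

  -- Λ(q,a,b,d,u) ≤ Λ(q,a',b',d',u')
  ΛLe : (a b d u a' b' d' u' : ℕ) → Set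
  ΛLe a b d u a' b' d' u' =
    ∀ N (C : Fin N → Mat a b) → IsCode a b d u N C →
    Σ ℕ λ N' → Σ (Fin N' → Mat a' b') λ C' → IsCode a' b' d' u' N' C' × (N ≤ N')

  -- Λ(q,a,b,d,u) ≤ B
  ΛLeN : (a b d u B : ℕ) → Set
  ΛLeN a b d u B = ∀ N (C : Fin N → Mat a b) → IsCode a b d u N C → N ≤ B

open Nat using (_+_; _*_; _∸_; _^_; _/_)

sumTo : ℕ → (ℕ → ℕ) → ℕ
sumTo zero    f = f 0
sumTo (suc n) f = sumTo n f + f (suc n)

prodBelow : ℕ → (ℕ → ℕ) → ℕ
prodBelow zero    f = 1
prodBelow (suc n) f = prodBelow n f * f n

-- [n]_q = (q^n - 1)/(q - 1) = Σ_{i<n} q^i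
qInt : ℕ → ℕ → ℕ
qInt q n = sumBelow n
  where
  sumBelow : ℕ → ℕ
  sumBelow zero    = 0
  sumBelow (suc m) = sumBelow m + q ^ m

qFact : ℕ → ℕ → ℕ
qFact q r = prodBelow r (λ i → qInt q (suc i))

-- natural division, with the convention n / 0 = 0 (never used for q ≥ 2)
divℕ : ℕ → ℕ → ℕ
divℕ n zero    = 0
divℕ n (suc m) = n / suc m

gauss : ℕ → ℕ → ℕ → ℕ
gauss q n k = divℕ (prodBelow k (λ i → q ^ n ∸ q ^ i))
                   (prodBelow k (λ i → q ^ k ∸ q ^ i))

module Submission where

-- Puncturing one column lowers every rank distance by at most one, which gives the first
-- inequality.  For the bound let m = min{a,b} - d + 1 and suppose a ≤ b.  Keeping only the
-- first m rows is injective on a code of minimum distance d, since two codewords agreeing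
-- there differ by a matrix with only a - m = d - 1 possibly nonzero rows, and it does not
-- increase ranks.  So the code is no larger than the set of m × b matrices of rank ≤ u.
-- Building a basis of the columns greedily yields the q-Pascal recurrence, so the m × b
-- matrices of rank r number at most [b r]_q ∏_{i<r} (q^m - q^i), which equals
-- q^(r choose 2) (q-1)^r [r]_q! [m r]_q [b r]_q.  For a > b one keeps the first m columns.

open import Defs
open import Data.Nat using (ℕ; _+_; _*_; _∸_; _^_; _≤_; _⊓_; _⊔_)
open import Data.Nat.Combinatorics using (_C_)
open import Data.Product using (_×_)

open import Data.Nat using (zero; suc; _<_; z≤n; s≤s; NonZero; >-nonZero)
import Data.Nat.Properties as ℕ
open import Data.Nat.Combinatorics using (nCk+nC[k+1]≡[n+1]C[k+1]; nC1≡n)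
open import Data.Nat.DivMod using (m*n/n≡m)
open import Data.Nat.Tactic.RingSolver using (solve-∀)
open import Data.Fin as Fin using (Fin; zero; suc; punchIn; punchOut; _↑ˡ_; _↑ʳ_; splitAt; join; combine)
import Data.Fin.Properties as Fin
open import Data.Vec using (Vec; []; _∷_; head; tail; lookup; tabulate)
import Data.Vec.Properties as Vec
open import Data.Vec.Functional using (removeAt; insertAt)
open import Data.Vec.Functional.Properties using (insertAt-lookup; insertAt-punchIn)
open import Data.Product using (∃; _,_; proj₁; proj₂)
open import Data.Sum as Sum using (_⊎_; inj₁; inj₂)
import Data.Sum.Properties as Sum
open import Data.Empty using (⊥-elim)
open import Function using (_∘_)
open import Function.Definitions using (Injective)
open import Relation.Nullary using (¬_; Dec; yes; no)
import Relation.Nullary.Decidable as Dec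
open import Relation.Binary.PropositionalEquality
  using (_≡_; _≢_; refl; sym; trans; cong; cong₂; subst; module ≡-Reasoning)
import Relation.Binary.Reasoning.Setoid

-- Counting by injections into Fin

record AtMost {A : Set} (K : ℕ) (P : A → Set) : Set where
  field
    index           : ∀ x → P x → Fin K
    index-injective : ∀ x y (px : P x) (py : P y) → index x px ≡ index y py → x ≡ y
open AtMost

module _ {A : Set} where

  AtMost-bound : ∀ {K N} {P : A → Set} → AtMost K P → (f : Fin N → A) →
                 (∀ i → P (f i)) → Injective _≡_ _≡_ f → N ≤ K
  AtMost-bound c f Pf f-inj = Fin.injective⇒≤ λ e → f-inj (index-injective c _ _ (Pf _) (Pf _) e)

  AtMost-mono : ∀ {K} {P Q : A → Set} → (∀ x → P x → Q x) → AtMost K Q → AtMost K P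
  AtMost-mono P⇒Q c = record
    { index           = λ x px → index c x (P⇒Q x px)
    ; index-injective = λ x y _ _ → index-injective c x y _ _
    }

  AtMost-resize : ∀ {K L} {P : Set} {Q : A → Set} → (P → K ≡ L) → AtMost K Q → AtMost L (λ x → P × Q x)
  AtMost-resize K≡L c = record
    { index           = λ x (p , qx) → Fin.cast (K≡L p) (index c x qx)
    ; index-injective = λ x y (p , qx) (p′ , qy) e → index-injective c x y qx qy (Fin.toℕ-injective (begin
        Fin.toℕ (index c x qx)                    ≡⟨ Fin.toℕ-cast (K≡L p) _ ⟨
        Fin.toℕ (Fin.cast (K≡L p) (index c x qx))  ≡⟨ cong Fin.toℕ e ⟩
        Fin.toℕ (Fin.cast (K≡L p′) (index c y qy)) ≡⟨ Fin.toℕ-cast (K≡L p′) _ ⟩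
        Fin.toℕ (index c y qy)                    ∎))
    }
    where open ≡-Reasoning

  AtMost-⊎ : ∀ {K L} {P Q R : A → Set} → AtMost K P → AtMost L Q →
             (∀ x → R x → P x ⊎ Q x) → AtMost (K + L) R
  AtMost-⊎ {K} {L} {P} {Q} cP cQ split = record
    { index           = λ x r → join K L (tag x (split x r))
    ; index-injective = λ x y r s e → untag x y (split x r) (split y s) (join-injective e)
    }
    where
    tag : ∀ x → P x ⊎ Q x → Fin K ⊎ Fin L
    tag x = Sum.map (index cP x) (index cQ x)
    join-injective : ∀ {i j} → join K L i ≡ join K L j → i ≡ j
    join-injective {i} {j} e = begin
      i                        ≡⟨ Fin.splitAt-join K L i ⟨
      splitAt K (join K L i)   ≡⟨ cong (splitAt K) e ⟩
      splitAt K (join K L j)   ≡⟨ Fin.splitAt-join K L j ⟩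
      j                        ∎
      where open ≡-Reasoning
    untag : ∀ x y p q → tag x p ≡ tag y q → x ≡ y
    untag x y (inj₁ p) (inj₁ p′) e = index-injective cP x y p p′ (Sum.inj₁-injective e)
    untag x y (inj₂ q) (inj₂ q′) e = index-injective cQ x y q q′ (Sum.inj₂-injective e)

  AtMost-∷ : ∀ {K L s} {P : Vec A s → Set} {Q : Vec A s → A → Set} →
             AtMost K P → (∀ xs → AtMost L (λ x → P xs × Q xs x)) →
             AtMost (K * L) (λ xs → P (tail xs) × Q (tail xs) (head xs))
  AtMost-∷ {P = P} {Q} cP cQ = record { index = idx ; index-injective = idx-injective }
    where
    idx : ∀ xs → P (tail xs) × Q (tail xs) (head xs) → Fin _
    idx (x ∷ xs) (p , q) = combine (index cP xs p) (index (cQ xs) x (p , q))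
    idx-injective : ∀ xs ys pxs pys → idx xs pxs ≡ idx ys pys → xs ≡ ys
    idx-injective (x ∷ xs) (y ∷ ys) (p , q) (p′ , q′) e
      with Fin.combine-injective (index cP xs p) _ (index cP ys p′) _ e
    ... | e₁ , e₂ with index-injective cP xs ys p p′ e₁
    ... | refl = cong (_∷ xs) (index-injective (cQ xs) x y _ _ e₂)

-- Removing f 0 from the codomain by punchOut leaves an injection Fin a → Fin b.
AtMost-complement : ∀ {a b} (f : Fin a → Fin b) → Injective _≡_ _≡_ f →
                    AtMost (b ∸ a) (λ y → ∀ x → f x ≢ y)
AtMost-complement {zero} f _ = record
  { index = λ y _ → y ; index-injective = λ _ _ _ _ e → e }
AtMost-complement {suc a} {zero} f _ with f zero
... | ()
AtMost-complement {suc a} {suc b} f f-inj = record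
  { index           = λ y y∉f → index rest (punchOut (y∉f zero)) (avoids y∉f)
  ; index-injective = λ y z y∉f z∉f e →
      Fin.punchOut-injective (y∉f zero) (z∉f zero) (index-injective rest _ _ _ _ e)
  }
  where
  f0≢f : ∀ x → f zero ≢ f (suc x)
  f0≢f x e with f-inj e
  ... | ()
  f′ : Fin a → Fin b
  f′ x = punchOut (f0≢f x)
  rest : AtMost (b ∸ a) (λ y → ∀ x → f′ x ≢ y)
  rest = AtMost-complement f′ λ {x} {y} e →
    Fin.suc-injective (f-inj (Fin.punchOut-injective (f0≢f x) (f0≢f y) e))
  avoids : ∀ {y} (y∉f : ∀ x → f x ≢ y) → ∀ x → f′ x ≢ punchOut (y∉f zero)
  avoids y∉f x e = y∉f (suc x) (Fin.punchOut-injective (f0≢f x) (y∉f zero) e)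

-- q-analogues

∸-+-∸ : ∀ {a b c} → c ≤ b → b ≤ a → (a ∸ b) + (b ∸ c) ≡ a ∸ c
∸-+-∸ {a} {b} {c} c≤b b≤a = begin
  (a ∸ b) + (b ∸ c)   ≡⟨ ℕ.+-∸-assoc (a ∸ b) c≤b ⟨
  (a ∸ b) + b ∸ c     ≡⟨ cong (_∸ c) (ℕ.m∸n+n≡m b≤a) ⟩
  a ∸ c               ∎
  where open ≡-Reasoning

module _ (q : ℕ) where

  -- the number of linearly independent r-tuples in F_q^n
  falling : ℕ → ℕ → ℕ
  falling n r = prodBelow r (λ i → q ^ n ∸ q ^ i)

  qBinom : ℕ → ℕ → ℕ
  qBinom n       zero    = 1
  qBinom zero    (suc k) = 0
  qBinom (suc n) (suc k) = q ^ suc k * qBinom n (suc k) + qBinom n k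

  qBinom-zero : ∀ {n k} → n < k → qBinom n k ≡ 0
  qBinom-zero {zero}  {suc k} _         = refl
  qBinom-zero {suc n} {suc k} (s≤s n<k) = begin
    q ^ suc k * qBinom n (suc k) + qBinom n k
      ≡⟨ cong₂ (λ x y → q ^ suc k * x + y) (qBinom-zero (ℕ.m<n⇒m<1+n n<k)) (qBinom-zero n<k) ⟩
    q ^ suc k * 0 + 0
      ≡⟨ cong (_+ 0) (ℕ.*-zeroʳ (q ^ suc k)) ⟩
    0 ∎
    where open ≡-Reasoning

  falling-zero : ∀ {n r} → n < r → falling n r ≡ 0
  falling-zero {n} {suc r} (s≤s n≤r) with ℕ.m≤n⇒m<n∨m≡n n≤r
  ... | inj₁ n<r  = cong (_* (q ^ n ∸ q ^ r)) (falling-zero n<r)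
  ... | inj₂ refl = trans (cong (falling n n *_) (ℕ.n∸n≡0 (q ^ n))) (ℕ.*-zeroʳ (falling n n))

  falling-suc : ∀ n r → falling (suc n) (suc r) ≡ (q ^ suc n ∸ 1) * q ^ r * falling n r
  falling-suc n zero    =
    trans (ℕ.*-identityˡ _) (sym (trans (ℕ.*-identityʳ _) (ℕ.*-identityʳ _)))
  falling-suc n (suc r) = begin
    falling (suc n) (suc r) * (q ^ suc n ∸ q ^ suc r)
      ≡⟨ cong₂ _*_ (falling-suc n r) (sym (ℕ.*-distribˡ-∸ q (q ^ n) (q ^ r))) ⟩
    (q ^ suc n ∸ 1) * q ^ r * falling n r * (q * (q ^ n ∸ q ^ r))
      ≡⟨ shuffle (q ^ suc n ∸ 1) (q ^ r) (falling n r) q (q ^ n ∸ q ^ r) ⟩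
    (q ^ suc n ∸ 1) * (q * q ^ r) * (falling n r * (q ^ n ∸ q ^ r)) ∎
    where
    open ≡-Reasoning
    shuffle : ∀ a b c d e → a * b * c * (d * e) ≡ a * (d * b) * (c * e)
    shuffle = solve-∀

module _ (q : ℕ) .{{_ : NonZero q}} where

  private
    q^-mono : ∀ {m n} → m ≤ n → q ^ m ≤ q ^ n
    q^-mono = ℕ.^-monoʳ-≤ q

  -- When r > n both sides vanish; otherwise the bracket telescopes to q^(n+1) - 1.
  falling-telescope : ∀ n r →
    falling q n r * (q ^ suc n ∸ 1) ≡ falling q n r * (q * (q ^ n ∸ q ^ r) + (q ^ suc r ∸ 1))
  falling-telescope n r with r ℕ.≤? n
  ... | yes r≤n = cong (falling q n r *_) (begin
    q ^ suc n ∸ 1                              ≡⟨ ∸-+-∸ (q^-mono {0} {suc r} z≤n) (q^-mono (s≤s r≤n)) ⟨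
    (q ^ suc n ∸ q ^ suc r) + (q ^ suc r ∸ 1)  ≡⟨ cong (_+ (q ^ suc r ∸ 1)) (ℕ.*-distribˡ-∸ q (q ^ n) (q ^ r)) ⟨
    q * (q ^ n ∸ q ^ r) + (q ^ suc r ∸ 1)      ∎)
    where open ≡-Reasoning
  ... | no r≰n rewrite falling-zero q (ℕ.≰⇒> r≰n) = refl

  falling-pascal : ∀ n r →
    falling q (suc n) (suc r) ≡ q ^ suc r * falling q n (suc r) + (q ^ suc r ∸ 1) * q ^ r * falling q n r
  falling-pascal n r = begin
    falling q (suc n) (suc r)                              ≡⟨ falling-suc q n r ⟩
    (q ^ suc n ∸ 1) * q ^ r * F                            ≡⟨ shuffle (q ^ suc n ∸ 1) (q ^ r) F ⟩
    q ^ r * (F * (q ^ suc n ∸ 1))                          ≡⟨ cong (q ^ r *_) (falling-telescope n r) ⟩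
    q ^ r * (F * (q * (q ^ n ∸ q ^ r) + (q ^ suc r ∸ 1)))  ≡⟨ expand (q ^ r) F q (q ^ n ∸ q ^ r) (q ^ suc r ∸ 1) ⟩
    q ^ suc r * falling q n (suc r) + (q ^ suc r ∸ 1) * q ^ r * F ∎
    where
    open ≡-Reasoning
    F = falling q n r
    shuffle : ∀ a b c → a * b * c ≡ b * (c * a)
    shuffle = solve-∀
    expand : ∀ b c d e f → b * (c * (d * e + f)) ≡ d * b * (c * e) + f * b * c
    expand = solve-∀

  falling≡qBinom*falling : ∀ n r → falling q n r ≡ qBinom q n r * falling q r r
  falling≡qBinom*falling n       zero    = refl
  falling≡qBinom*falling zero    (suc r) = falling-zero q {0} {suc r} (s≤s z≤n)
  falling≡qBinom*falling (suc n) (suc r) = begin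
    falling q (suc n) (suc r)
      ≡⟨ falling-pascal n r ⟩
    q ^ suc r * falling q n (suc r) + (q ^ suc r ∸ 1) * q ^ r * falling q n r
      ≡⟨ cong₂ (λ x y → q ^ suc r * x + (q ^ suc r ∸ 1) * q ^ r * y)
               (falling≡qBinom*falling n (suc r)) (falling≡qBinom*falling n r) ⟩
    q ^ suc r * (B′ * D′) + (q ^ suc r ∸ 1) * q ^ r * (B * D)
      ≡⟨ cong (λ x → q ^ suc r * (B′ * x) + (q ^ suc r ∸ 1) * q ^ r * (B * D)) (falling-suc q r r) ⟩
    q ^ suc r * (B′ * ((q ^ suc r ∸ 1) * q ^ r * D)) + (q ^ suc r ∸ 1) * q ^ r * (B * D)
      ≡⟨ factor (q ^ suc r) B′ (q ^ suc r ∸ 1) (q ^ r) D B ⟩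
    (q ^ suc r * B′ + B) * ((q ^ suc r ∸ 1) * q ^ r * D)
      ≡⟨ cong (qBinom q (suc n) (suc r) *_) (falling-suc q r r) ⟨
    qBinom q (suc n) (suc r) * D′ ∎
    where
    open ≡-Reasoning
    B  = qBinom q n r
    B′ = qBinom q n (suc r)
    D  = falling q r r
    D′ = falling q (suc r) (suc r)
    factor : ∀ a b c d e f → a * (b * (c * d * e)) + c * d * (f * e) ≡ (a * b + f) * (c * d * e)
    factor = solve-∀

  [q∸1]*qInt≡q^n∸1 : ∀ n → (q ∸ 1) * qInt q n ≡ q ^ n ∸ 1
  [q∸1]*qInt≡q^n∸1 zero    = ℕ.*-zeroʳ (q ∸ 1)
  [q∸1]*qInt≡q^n∸1 (suc n) = begin
    (q ∸ 1) * (qInt q n + q ^ n)           ≡⟨ ℕ.*-distribˡ-+ (q ∸ 1) (qInt q n) (q ^ n) ⟩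
    (q ∸ 1) * qInt q n + (q ∸ 1) * q ^ n   ≡⟨ cong₂ _+_ ([q∸1]*qInt≡q^n∸1 n) (ℕ.*-distribʳ-∸ (q ^ n) q 1) ⟩
    (q ^ n ∸ 1) + (q * q ^ n ∸ 1 * q ^ n)  ≡⟨ cong (λ x → (q ^ n ∸ 1) + (q ^ suc n ∸ x)) (ℕ.*-identityˡ (q ^ n)) ⟩
    (q ^ n ∸ 1) + (q ^ suc n ∸ q ^ n)      ≡⟨ ℕ.+-comm (q ^ n ∸ 1) _ ⟩
    (q ^ suc n ∸ q ^ n) + (q ^ n ∸ 1)      ≡⟨ ∸-+-∸ (q^-mono {0} {n} z≤n) (q^-mono (ℕ.n≤1+n n)) ⟩
    q ^ suc n ∸ 1                          ∎
    where open ≡-Reasoning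

  falling-diagonal : ∀ r → falling q r r ≡ q ^ (r C 2) * (q ∸ 1) ^ r * qFact q r
  falling-diagonal zero    = refl
  falling-diagonal (suc r) = begin
    falling q (suc r) (suc r)
      ≡⟨ falling-suc q r r ⟩
    (q ^ suc r ∸ 1) * q ^ r * falling q r r
      ≡⟨ cong₂ (λ x y → x * q ^ r * y) (sym ([q∸1]*qInt≡q^n∸1 (suc r))) (falling-diagonal r) ⟩
    (q ∸ 1) * qInt q (suc r) * q ^ r * (q ^ (r C 2) * (q ∸ 1) ^ r * qFact q r)
      ≡⟨ shuffle (q ∸ 1) (qInt q (suc r)) (q ^ r) (q ^ (r C 2)) ((q ∸ 1) ^ r) (qFact q r) ⟩
    q ^ r * q ^ (r C 2) * (q ∸ 1) ^ suc r * qFact q (suc r)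
      ≡⟨ cong (λ x → x * (q ∸ 1) ^ suc r * qFact q (suc r)) (ℕ.^-distribˡ-+-* q r (r C 2)) ⟨
    q ^ (r + r C 2) * (q ∸ 1) ^ suc r * qFact q (suc r)
      ≡⟨ cong (λ k → q ^ k * (q ∸ 1) ^ suc r * qFact q (suc r)) [1+r]C2 ⟨
    q ^ (suc r C 2) * (q ∸ 1) ^ suc r * qFact q (suc r) ∎
    where
    open ≡-Reasoning
    shuffle : ∀ a b c d e f → a * b * c * (d * e * f) ≡ c * d * (a * e) * (f * b)
    shuffle = solve-∀
    [1+r]C2 : suc r C 2 ≡ r + r C 2
    [1+r]C2 = trans (sym (nCk+nC[k+1]≡[n+1]C[k+1] r 1)) (cong (_+ r C 2) (nC1≡n r))

sumTo-cong : ∀ u {f g : ℕ → ℕ} → (∀ r → f r ≡ g r) → sumTo u f ≡ sumTo u g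
sumTo-cong zero    f≗g = f≗g 0
sumTo-cong (suc u) f≗g = cong₂ _+_ (sumTo-cong u f≗g) (f≗g (suc u))

sumTo-vanishing : ∀ {m u} {f : ℕ → ℕ} → m ≤ u → (∀ r → m < r → f r ≡ 0) → sumTo u f ≡ sumTo m f
sumTo-vanishing {u = zero}  z≤n _ = refl
sumTo-vanishing {m} {suc u} {f} m≤1+u f>m≡0 with ℕ.m≤n⇒m<n∨m≡n m≤1+u
... | inj₂ refl      = refl
... | inj₁ (s≤s m≤u) = begin
  sumTo u f + f (suc u)   ≡⟨ cong₂ _+_ (sumTo-vanishing m≤u f>m≡0) (f>m≡0 (suc u) (s≤s m≤u)) ⟩
  sumTo m f + 0           ≡⟨ ℕ.+-identityʳ _ ⟩
  sumTo m f               ∎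
  where open ≡-Reasoning

sumTo-truncate : ∀ u m {f : ℕ → ℕ} → (∀ r → m < r → f r ≡ 0) → sumTo u f ≡ sumTo (u ⊓ m) f
sumTo-truncate u m {f} f>m≡0 with ℕ.≤-total u m
... | inj₁ u≤m = cong (λ k → sumTo k f) (sym (ℕ.m≤n⇒m⊓n≡m u≤m))
... | inj₂ m≤u = trans (sumTo-vanishing m≤u f>m≡0) (cong (λ k → sumTo k f) (sym (ℕ.m≥n⇒m⊓n≡n m≤u)))

prodBelow-positive : ∀ r (f : ℕ → ℕ) → (∀ i → i < r → 0 < f i) → 0 < prodBelow r f
prodBelow-positive zero    f f>0 = s≤s z≤n
prodBelow-positive (suc r) f f>0 =
  ℕ.*-mono-≤ (prodBelow-positive r f (λ i i<r → f>0 i (ℕ.m<n⇒m<1+n i<r))) (f>0 r (ℕ.n<1+n r))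

divℕ-* : ∀ a {b} → 0 < b → divℕ (a * b) b ≡ a
divℕ-* a {suc b} _ = m*n/n≡m a (suc b)

-- The summand of the bound, with m = min{a,b} - d + 1 and M = max{a,b}.
term : ℕ → ℕ → ℕ → ℕ → ℕ
term q m M r = q ^ (r C 2) * (q ∸ 1) ^ r * qFact q r * gauss q m r * gauss q M r

boundΛ : ℕ → ℕ → ℕ → ℕ → ℕ
boundΛ q u m M = sumTo (u ⊓ m) (term q m M)

module _ {q : ℕ} (2≤q : 2 ≤ q) where

  private instance
    q≢0 : NonZero q
    q≢0 = >-nonZero (ℕ.≤-trans (s≤s z≤n) 2≤q)

  gauss≡qBinom : ∀ n r → gauss q n r ≡ qBinom q n r
  gauss≡qBinom n r = begin
    divℕ (falling q n r) (falling q r r)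
      ≡⟨ cong (λ x → divℕ x (falling q r r)) (falling≡qBinom*falling q n r) ⟩
    divℕ (qBinom q n r * falling q r r) (falling q r r)
      ≡⟨ divℕ-* (qBinom q n r) falling-diagonal-positive ⟩
    qBinom q n r ∎
    where
    open ≡-Reasoning
    falling-diagonal-positive : 0 < falling q r r
    falling-diagonal-positive =
      prodBelow-positive r _ λ i i<r → ℕ.m<n⇒0<n∸m (ℕ.^-monoʳ-< q 2≤q i<r)

  qBinom*falling≡term : ∀ p s r → qBinom q s r * falling q p r ≡ term q p s r
  qBinom*falling≡term p s r = begin
    qBinom q s r * falling q p r
      ≡⟨ cong (qBinom q s r *_) (falling≡qBinom*falling q p r) ⟩
    qBinom q s r * (qBinom q p r * falling q r r)
      ≡⟨ cong (λ x → qBinom q s r * (qBinom q p r * x)) (falling-diagonal q r) ⟩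
    qBinom q s r * (qBinom q p r * (q ^ (r C 2) * (q ∸ 1) ^ r * qFact q r))
      ≡⟨ shuffle (qBinom q s r) (qBinom q p r) (q ^ (r C 2) * (q ∸ 1) ^ r * qFact q r) ⟩
    q ^ (r C 2) * (q ∸ 1) ^ r * qFact q r * qBinom q p r * qBinom q s r
      ≡⟨ cong₂ (λ x y → q ^ (r C 2) * (q ∸ 1) ^ r * qFact q r * x * y) (gauss≡qBinom p r) (gauss≡qBinom s r) ⟨
    term q p s r ∎
    where
    open ≡-Reasoning
    shuffle : ∀ a b c → a * (b * c) ≡ c * b * a
    shuffle = solve-∀

  term-comm : ∀ m M r → term q m M r ≡ term q M m r
  term-comm m M r = swap (q ^ (r C 2) * (q ∸ 1) ^ r * qFact q r) (gauss q m r) (gauss q M r)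
    where
    swap : ∀ a b c → a * b * c ≡ a * c * b
    swap = solve-∀

  term-vanishing : ∀ m M r → m < r → term q m M r ≡ 0
  term-vanishing m M r m<r = begin
    term q m M r                                          ≡⟨ cong (λ x → c * x * gauss q M r) (gauss≡qBinom m r) ⟩
    c * qBinom q m r * gauss q M r                        ≡⟨ cong (λ x → c * x * gauss q M r) (qBinom-zero q m<r) ⟩
    c * 0 * gauss q M r                                   ≡⟨ cong (_* gauss q M r) (ℕ.*-zeroʳ c) ⟩
    0                                                     ∎
    where
    open ≡-Reasoning
    c = q ^ (r C 2) * (q ∸ 1) ^ r * qFact q r

  rankCount≡boundΛ : ∀ u m M → sumTo u (λ r → qBinom q M r * falling q m r) ≡ boundΛ q u m M
  rankCount≡boundΛ u m M = trans (sumTo-cong u (qBinom*falling≡term m M))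
                                 (sumTo-truncate u m (term-vanishing m M))

  rankCount≡boundΛ-flip : ∀ u m M → sumTo u (λ r → qBinom q m r * falling q M r) ≡ boundΛ q u m M
  rankCount≡boundΛ-flip u m M =
    trans (sumTo-cong u (λ r → trans (qBinom*falling≡term M m r) (term-comm M m r)))
          (sumTo-truncate u m (term-vanishing m M))

-- Linear algebra over a finite field

module LinearAlgebra {q : ℕ} (F : FiniteField q) where
  open FiniteField F
    renaming (_+_ to _⊕_; _*_ to _⊗_; refl to ≈-refl; sym to ≈-sym; trans to ≈-trans; reflexive to ≈-reflexive)
    hiding (zero)
  open import Algebra.Properties.Semiring.Sum semiring
    using (sum; sum-remove; sum-cong-≋; sum-replicate-zero; ∑-distrib-+; *-distribˡ-sum)
  open import Algebra.Properties.Ring ring using (-1*x≈-x; [y-z]x≈yx-zx; -‿distribˡ-*)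
  open import Algebra.Properties.Group +-group using (x∙y⁻¹≈ε⇒x≈y; x≈y⇒x∙y⁻¹≈ε; inverseˡ-unique)
  module ≈-Reasoning = Relation.Binary.Reasoning.Setoid setoid

  ΣF≡sum : ∀ {k} (f : Fin k → Carrier) → ΣF F f ≡ sum f
  ΣF≡sum {zero}  f = refl
  ΣF≡sum {suc k} f = cong (f zero ⊕_) (ΣF≡sum (f ∘ suc))

  Family : ℕ → ℕ → Set
  Family k p = Fin k → Fin p → Carrier

  lincomb : ∀ {k p} → (Fin k → Carrier) → Family k p → Fin p → Carrier
  lincomb c W r = ΣF F (λ i → c i ⊗ W i r)

  lincomb≈sum : ∀ {k p} (c : Fin k → Carrier) (W : Family k p) r → lincomb c W r ≈ sum (λ i → c i ⊗ W i r)
  lincomb≈sum c W r = ≈-reflexive (ΣF≡sum (λ i → c i ⊗ W i r))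

  lincomb-cong : ∀ {k p} {c c′ : Fin k → Carrier} {W : Family k p} →
                 (∀ i → c i ≈ c′ i) → ∀ r → lincomb c W r ≈ lincomb c′ W r
  lincomb-cong {c = c} {c′} {W} c≈c′ r = begin
    lincomb c W r               ≈⟨ lincomb≈sum c W r ⟩
    sum (λ i → c i ⊗ W i r)    ≈⟨ sum-cong-≋ (λ i → *-cong (c≈c′ i) ≈-refl) ⟩
    sum (λ i → c′ i ⊗ W i r)   ≈⟨ lincomb≈sum c′ W r ⟨
    lincomb c′ W r              ∎
    where open ≈-Reasoning

  lincomb-zeroˡ : ∀ {k p} {c : Fin k → Carrier} (W : Family k p) → (∀ i → c i ≈ 0#) → ∀ r → lincomb c W r ≈ 0#
  lincomb-zeroˡ {k} {c = c} W c≈0 r = begin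
    lincomb c W r               ≈⟨ lincomb≈sum c W r ⟩
    sum (λ i → c i ⊗ W i r)    ≈⟨ sum-cong-≋ (λ i → ≈-trans (*-cong (c≈0 i) ≈-refl) (zeroˡ (W i r))) ⟩
    sum {k} (λ _ → 0#)          ≈⟨ sum-replicate-zero k ⟩
    0#                          ∎
    where open ≈-Reasoning

  lincomb-zeroʳ : ∀ {k p} (c : Fin k → Carrier) (W : Family k p) {r} → (∀ i → W i r ≈ 0#) → lincomb c W r ≈ 0#
  lincomb-zeroʳ {k} c W {r} W≈0 = begin
    lincomb c W r               ≈⟨ lincomb≈sum c W r ⟩
    sum (λ i → c i ⊗ W i r)    ≈⟨ sum-cong-≋ (λ i → ≈-trans (*-congˡ (W≈0 i)) (zeroʳ (c i))) ⟩
    sum {k} (λ _ → 0#)          ≈⟨ sum-replicate-zero k ⟩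
    0#                          ∎
    where open ≈-Reasoning

  lincomb-removeAt : ∀ {k p} (c : Fin (suc k) → Carrier) (W : Family (suc k) p) j r →
                     lincomb c W r ≈ c j ⊗ W j r ⊕ lincomb (removeAt c j) (removeAt W j) r
  lincomb-removeAt c W j r = begin
    lincomb c W r                                          ≈⟨ lincomb≈sum c W r ⟩
    sum (λ i → c i ⊗ W i r)                               ≈⟨ sum-remove {i = j} (λ i → c i ⊗ W i r) ⟩
    c j ⊗ W j r ⊕ sum (λ i → removeAt c j i ⊗ removeAt W j i r)
                                                           ≈⟨ +-congˡ (lincomb≈sum (removeAt c j) (removeAt W j) r) ⟨
    c j ⊗ W j r ⊕ lincomb (removeAt c j) (removeAt W j) r ∎
    where open ≈-Reasoning

  lincomb-scale : ∀ {k p} x (c : Fin k → Carrier) (W : Family k p) r →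
                  lincomb (λ i → x ⊗ c i) W r ≈ x ⊗ lincomb c W r
  lincomb-scale x c W r = begin
    lincomb (λ i → x ⊗ c i) W r        ≈⟨ lincomb≈sum _ W r ⟩
    sum (λ i → x ⊗ c i ⊗ W i r)        ≈⟨ sum-cong-≋ (λ i → *-assoc x (c i) (W i r)) ⟩
    sum (λ i → x ⊗ (c i ⊗ W i r))      ≈⟨ *-distribˡ-sum x (λ i → c i ⊗ W i r) ⟨
    x ⊗ sum (λ i → c i ⊗ W i r)        ≈⟨ *-congˡ (lincomb≈sum c W r) ⟨
    x ⊗ lincomb c W r                   ∎
    where open ≈-Reasoning

  lincomb-neg : ∀ {k p} (c : Fin k → Carrier) (W : Family k p) r →
                lincomb (λ i → - c i) W r ≈ - lincomb c W r
  lincomb-neg c W r = begin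
    lincomb (λ i → - c i) W r         ≈⟨ lincomb-cong {W = W} (λ i → -1*x≈-x (c i)) r ⟨
    lincomb (λ i → - 1# ⊗ c i) W r    ≈⟨ lincomb-scale (- 1#) c W r ⟩
    - 1# ⊗ lincomb c W r              ≈⟨ -1*x≈-x _ ⟩
    - lincomb c W r                   ∎
    where open ≈-Reasoning

  lincomb-sub : ∀ {k p} (a b : Fin k → Carrier) (W : Family k p) r →
                lincomb (λ i → a i - b i) W r ≈ lincomb a W r - lincomb b W r
  lincomb-sub a b W r = begin
    lincomb (λ i → a i - b i) W r                          ≈⟨ lincomb≈sum _ W r ⟩
    sum (λ i → (a i - b i) ⊗ W i r)                        ≈⟨ sum-cong-≋ (λ i → [y-z]x≈yx-zx (W i r) (a i) (b i)) ⟩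
    sum (λ i → a i ⊗ W i r - b i ⊗ W i r)                  ≈⟨ ∑-distrib-+ (λ i → a i ⊗ W i r) (λ i → - (b i ⊗ W i r)) ⟩
    sum (λ i → a i ⊗ W i r) ⊕ sum (λ i → - (b i ⊗ W i r))  ≈⟨ +-congˡ (sum-cong-≋ (λ i → -‿distribˡ-* (b i) (W i r))) ⟩
    sum (λ i → a i ⊗ W i r) ⊕ sum (λ i → - b i ⊗ W i r)    ≈⟨ +-cong (lincomb≈sum a W r) (lincomb≈sum _ W r) ⟨
    lincomb a W r ⊕ lincomb (λ i → - b i) W r              ≈⟨ +-congˡ (lincomb-neg b W r) ⟩
    lincomb a W r - lincomb b W r                          ∎
    where open ≈-Reasoning

  unit : ∀ {k} → Fin (suc k) → Fin (suc k) → Carrier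
  unit j = insertAt (λ _ → 0#) j 1#

  unit-≢ : ∀ {k} {i j : Fin (suc k)} → j ≢ i → unit j i ≡ 0#
  unit-≢ {j = j} j≢i = begin
    unit j _                          ≡⟨ cong (unit j) (Fin.punchIn-punchOut j≢i) ⟨
    unit j (punchIn j (punchOut j≢i)) ≡⟨ insertAt-punchIn (λ _ → 0#) j 1# (punchOut j≢i) ⟩
    0#                                ∎
    where open ≡-Reasoning

  lincomb-unit : ∀ {k p} (W : Family (suc k) p) j r → lincomb (unit j) W r ≈ W j r
  lincomb-unit W j r = begin
    lincomb (unit j) W r                                       ≈⟨ lincomb-removeAt (unit j) W j r ⟩
    unit j j ⊗ W j r ⊕ lincomb (removeAt (unit j) j) (removeAt W j) r
      ≈⟨ +-cong (*-cong (≈-reflexive (insertAt-lookup (λ _ → 0#) j 1#)) ≈-refl)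
                (lincomb-zeroˡ (removeAt W j) (λ i → ≈-reflexive (insertAt-punchIn (λ _ → 0#) j 1# i)) r) ⟩
    1# ⊗ W j r ⊕ 0#                                            ≈⟨ +-identityʳ _ ⟩
    1# ⊗ W j r                                                 ≈⟨ *-identityˡ _ ⟩
    W j r                                                      ∎
    where open ≈-Reasoning

  Independent : ∀ {k p} → Family k p → Set
  Independent = LinIndep F

  Independent-cong : ∀ {k p} {W W′ : Family k p} → (∀ i r → W i r ≈ W′ i r) → Independent W → Independent W′
  Independent-cong {W = W} {W′} W≈W′ ind c c·W′≈0 = ind c λ r → begin
    lincomb c W r               ≈⟨ lincomb≈sum c W r ⟩
    sum (λ i → c i ⊗ W i r)    ≈⟨ sum-cong-≋ (λ i → *-congˡ (W≈W′ i r)) ⟩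
    sum (λ i → c i ⊗ W′ i r)   ≈⟨ lincomb≈sum c W′ r ⟨
    lincomb c W′ r              ≈⟨ c·W′≈0 r ⟩
    0#                          ∎
    where open ≈-Reasoning

  Independent-removeAt : ∀ {k p} {W : Family (suc k) p} → Independent W → ∀ j → Independent (removeAt W j)
  Independent-removeAt {W = W} ind j c c·W∖j≈0 i =
    ≈-trans (≈-reflexive (sym (insertAt-punchIn c j 0# i))) (ind c′ c′·W≈0 (punchIn j i))
    where
    open ≈-Reasoning
    c′ = insertAt c j 0#
    c′·W≈0 : ∀ r → lincomb c′ W r ≈ 0#
    c′·W≈0 r = begin
      lincomb c′ W r                                          ≈⟨ lincomb-removeAt c′ W j r ⟩
      c′ j ⊗ W j r ⊕ lincomb (removeAt c′ j) (removeAt W j) r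
        ≈⟨ +-cong (≈-trans (*-cong (≈-reflexive (insertAt-lookup c j 0#)) ≈-refl) (zeroˡ _))
                  (lincomb-cong {W = removeAt W j} (λ i → ≈-reflexive (insertAt-punchIn c j 0# i)) r) ⟩
      0# ⊕ lincomb c (removeAt W j) r                         ≈⟨ +-identityˡ _ ⟩
      lincomb c (removeAt W j) r                              ≈⟨ c·W∖j≈0 r ⟩
      0#                                                      ∎

  lincomb-injective : ∀ {k p} {W : Family k p} → Independent W → ∀ a b →
                      (∀ r → lincomb a W r ≈ lincomb b W r) → ∀ i → a i ≈ b i
  lincomb-injective {W = W} ind a b a·W≈b·W i = x∙y⁻¹≈ε⇒x≈y _ _
    (ind (λ i → a i - b i) (λ r → ≈-trans (lincomb-sub a b W r) (x≈y⇒x∙y⁻¹≈ε (a·W≈b·W r))) i)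

  Independent-injective : ∀ {k p} {W : Family k p} → Independent W → ∀ {i j} → (∀ r → W i r ≈ W j r) → i ≡ j
  Independent-injective {suc k} {W = W} ind {i} {j} Wi≈Wj with i Fin.≟ j
  ... | yes i≡j = i≡j
  ... | no  i≢j = ⊥-elim (0≉1 (≈-sym (begin
    1#          ≈⟨ ≈-reflexive (insertAt-lookup (λ _ → 0#) i 1#) ⟨
    unit i i    ≈⟨ lincomb-injective {W = W} ind (unit i) (unit j) unit-i≈unit-j i ⟩
    unit j i    ≈⟨ ≈-reflexive (unit-≢ (i≢j ∘ sym)) ⟩
    0#          ∎)))
    where
    open ≈-Reasoning
    unit-i≈unit-j : ∀ r → lincomb (unit i) W r ≈ lincomb (unit j) W r
    unit-i≈unit-j r = ≈-trans (lincomb-unit W i r) (≈-trans (Wi≈Wj r) (≈-sym (lincomb-unit W j r)))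

  Independent-nonzero : ∀ {k p} {W : Family k p} → Independent W → ∀ j → ¬ (∀ r → W j r ≈ 0#)
  Independent-nonzero {suc k} {W = W} ind j Wj≈0 = 0≉1 (≈-sym (begin
    1#          ≈⟨ ≈-reflexive (insertAt-lookup (λ _ → 0#) j 1#) ⟨
    unit j j    ≈⟨ ind (unit j) (λ r → ≈-trans (lincomb-unit W j r) (Wj≈0 r)) j ⟩
    0#          ∎))
    where open ≈-Reasoning

  -- Vectors of F^p are coded by Fin (q ^ p) through the enumeration of F, so that
  -- counting them reduces to counting in Fin.
  position : Carrier → Fin q
  position x = proj₁ (enum-surj x)

  enum-position : ∀ x → enum (position x) ≈ x
  enum-position x = proj₂ (enum-surj x)

  position-injective : ∀ {x y} → position x ≡ position y → x ≈ y
  position-injective {x} {y} e =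
    ≈-trans (≈-sym (enum-position x)) (≈-trans (≈-reflexive (cong enum e)) (enum-position y))

  decode : ∀ {p} → Fin (q ^ p) → Fin p → Carrier
  decode {p} x r = enum (Fin.finToFun {q} {p} x r)

  encode : ∀ {p} → (Fin p → Carrier) → Fin (q ^ p)
  encode v = Fin.funToFin (position ∘ v)

  decode-encode : ∀ {p} (v : Fin p → Carrier) r → decode (encode v) r ≈ v r
  decode-encode v r =
    ≈-trans (≈-reflexive (cong enum (Fin.finToFun-funToFin (position ∘ v) r))) (enum-position (v r))

  funToFin-cong : ∀ {m n} {f g : Fin m → Fin n} → (∀ r → f r ≡ g r) → Fin.funToFin f ≡ Fin.funToFin g
  funToFin-cong {zero}  f≗g = refl
  funToFin-cong {suc m} f≗g = cong₂ combine (f≗g zero) (funToFin-cong (f≗g ∘ suc))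

  decode-injective : ∀ {p} {x y : Fin (q ^ p)} → (∀ r → decode {p} x r ≈ decode y r) → x ≡ y
  decode-injective {p} {x} {y} x≈y = begin
    x                                    ≡⟨ Fin.funToFin-finToFin {p} {q} x ⟨
    Fin.funToFin (Fin.finToFun {q} {p} x) ≡⟨ funToFin-cong {p} (λ r → enum-inj _ _ (x≈y r)) ⟩
    Fin.funToFin (Fin.finToFun {q} {p} y) ≡⟨ Fin.funToFin-finToFin {p} {q} y ⟩
    y                                    ∎
    where open ≡-Reasoning

  _≈?_ : ∀ x y → Dec (x ≈ y)
  x ≈? y = Dec.map′ position-injective (enum-inj _ _ ∘ enum-position-cong) (position x Fin.≟ position y)
    where
    enum-position-cong : x ≈ y → enum (position x) ≈ enum (position y)
    enum-position-cong x≈y = ≈-trans (enum-position x) (≈-trans x≈y (≈-sym (enum-position y)))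

  2≤q : 2 ≤ q
  2≤q = two-points (position 0#) (position 1#) (0≉1 ∘ position-injective)
    where
    two-points : ∀ {n} (i j : Fin n) → i ≢ j → 2 ≤ n
    two-points {suc zero}    zero zero i≢j = ⊥-elim (i≢j refl)
    two-points {suc (suc n)} _    _    _   = s≤s (s≤s z≤n)

  _∈span_ : ∀ {k p} → (Fin p → Carrier) → Family k p → Set
  _∈span_ {k} v W = ∃ λ (c : Fin (q ^ k)) → ∀ r → lincomb (decode c) W r ≈ v r

  _∈span?_ : ∀ {k p} v (W : Family k p) → Dec (v ∈span W)
  v ∈span? W = Fin.any? λ c → Fin.all? λ r → lincomb (decode c) W r ≈? v r

  Independent-extend : ∀ {k p} (V : Family (suc k) p) → Independent (V ∘ suc) → ¬ (V zero ∈span (V ∘ suc)) →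
                       Independent V
  Independent-extend {k} V ind V₀∉span c c·V≈0 with c zero ≈? 0#
  ... | yes c₀≈0 = λ where
      zero    → c₀≈0
      (suc i) → ind (c ∘ suc) (λ r → begin
        lincomb (c ∘ suc) (V ∘ suc) r                      ≈⟨ +-identityˡ _ ⟨
        0# ⊕ lincomb (c ∘ suc) (V ∘ suc) r                 ≈⟨ +-congʳ (≈-trans (*-congʳ c₀≈0) (zeroˡ _)) ⟨
        c zero ⊗ V zero r ⊕ lincomb (c ∘ suc) (V ∘ suc) r  ≈⟨ c·V≈0 r ⟩
        0#                                                 ∎) i
    where open ≈-Reasoning
  -- Otherwise V 0 = - c₀⁻¹ (Σ cᵢ Vᵢ) lies in the span of the others.
  ... | no c₀≉0 = ⊥-elim (V₀∉span (encode d , λ r → begin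
    lincomb (decode (encode d)) (V ∘ suc) r        ≈⟨ lincomb-cong {W = V ∘ suc} (decode-encode d) r ⟩
    lincomb d (V ∘ suc) r                          ≈⟨ lincomb-neg (λ i → y ⊗ c (suc i)) (V ∘ suc) r ⟩
    - lincomb (λ i → y ⊗ c (suc i)) (V ∘ suc) r    ≈⟨ -‿cong (lincomb-scale y (c ∘ suc) (V ∘ suc) r) ⟩
    - (y ⊗ T r)                                    ≈⟨ inverseˡ-unique _ _ (y·V₀+y·T≈0 r) ⟨
    V zero r                                       ∎))
    where
    open ≈-Reasoning
    y = proj₁ (inverse (c zero) c₀≉0)
    c₀y≈1 = proj₂ (inverse (c zero) c₀≉0)
    d : Fin k → Carrier
    d i = - (y ⊗ c (suc i))
    T = lincomb (c ∘ suc) (V ∘ suc)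
    y·V₀+y·T≈0 : ∀ r → V zero r ⊕ y ⊗ T r ≈ 0#
    y·V₀+y·T≈0 r = begin
      V zero r ⊕ y ⊗ T r                   ≈⟨ +-congʳ (*-identityˡ _) ⟨
      1# ⊗ V zero r ⊕ y ⊗ T r              ≈⟨ +-congʳ (*-congʳ (≈-trans (*-comm _ _) c₀y≈1)) ⟨
      y ⊗ c zero ⊗ V zero r ⊕ y ⊗ T r      ≈⟨ +-congʳ (*-assoc _ _ _) ⟩
      y ⊗ (c zero ⊗ V zero r) ⊕ y ⊗ T r    ≈⟨ distribˡ _ _ _ ⟨
      y ⊗ (c zero ⊗ V zero r ⊕ T r)        ≈⟨ *-congˡ (c·V≈0 r) ⟩
      y ⊗ 0#                               ≈⟨ zeroʳ _ ⟩
      0#                                   ∎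

  spanning : ∀ {k p} → Family k p → Fin (q ^ k) → Fin (q ^ p)
  spanning {k} W c = encode (lincomb (decode {k} c) W)

  decode-spanning : ∀ {k p} (W : Family k p) c r → decode (spanning W c) r ≈ lincomb (decode c) W r
  decode-spanning W c = decode-encode (lincomb (decode c) W)

  spanning-injective : ∀ {k p} {W : Family k p} → Independent W → Injective _≡_ _≡_ (spanning W)
  spanning-injective {W = W} ind {c} {c′} e =
    decode-injective (lincomb-injective {W = W} ind (decode c) (decode c′) λ r → begin
      lincomb (decode c) W r      ≈⟨ decode-spanning W c r ⟨
      decode (spanning W c) r     ≡⟨ cong (λ x → decode x r) e ⟩
      decode (spanning W c′) r    ≈⟨ decode-spanning W c′ r ⟩
      lincomb (decode c′) W r     ∎)
    where open ≈-Reasoning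

  Independent⇒≤ : ∀ {k p} {W : Family k p} → Independent W → k ≤ p
  Independent⇒≤ {W = W} ind = ℕ.≮⇒≥ λ p<k →
    ℕ.<⇒≱ (ℕ.^-monoʳ-< q 2≤q p<k) (Fin.injective⇒≤ (spanning-injective {W = W} ind))

  ∈span-atMost : ∀ {k p} (W : Family k p) → AtMost (q ^ k) (λ v → decode {p} v ∈span W)
  ∈span-atMost W = record
    { index           = λ _ → proj₁
    ; index-injective = λ { v w (c , c·W≈v) (.c , c·W≈w) refl →
        decode-injective λ r → ≈-trans (≈-sym (c·W≈v r)) (c·W≈w r) }
    }

  ∉span-atMost : ∀ {k p} {W : Family k p} → Independent W →
                 AtMost (q ^ p ∸ q ^ k) (λ v → ¬ decode {p} v ∈span W)
  ∉span-atMost {W = W} ind =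
    AtMost-mono (λ v v∉span c e → v∉span (c , λ r →
                  ≈-trans (≈-sym (decode-spanning W c r)) (≈-reflexive (cong (λ x → decode x r) e))))
                (AtMost-complement (spanning W) (spanning-injective {W = W} ind))

  Independent-sub : ∀ {n k p} {W : Family k p} → n ≤ k → Independent W →
                    ∃ λ (ρ : Fin n → Fin k) → Independent (W ∘ ρ)
  Independent-sub {k = zero}  z≤n   _   = (λ ()) , λ _ _ ()
  Independent-sub {k = suc k} {W = W} n≤1+k ind with ℕ.m≤n⇒m<n∨m≡n n≤1+k
  ... | inj₂ refl      = (λ i → i) , ind
  ... | inj₁ (s≤s n≤k) with Independent-sub {W = W ∘ suc} n≤k (Independent-removeAt {W = W} ind zero)
  ...   | ρ , ind′ = suc ∘ ρ , ind′

  module ColumnSpace (p : ℕ) where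

    family : ∀ {k} → Vec (Fin (q ^ p)) k → Family k p
    family W i = decode (lookup W i)

    adjoin : ∀ {k} → Vec (Fin (q ^ p)) k → Fin (q ^ p) → ∃ (Vec (Fin (q ^ p)))
    adjoin W x with decode x ∈span? family W
    ... | yes _ = _ , W
    ... | no  _ = _ , x ∷ W

    basis : ∀ {s} → Vec (Fin (q ^ p)) s → ∃ (Vec (Fin (q ^ p)))
    basis []       = _ , []
    basis (x ∷ xs) = adjoin (proj₂ (basis xs)) x

    rank : ∀ {s} → Vec (Fin (q ^ p)) s → ℕ
    rank xs = proj₁ (basis xs)

    basisFamily : ∀ {s} (xs : Vec (Fin (q ^ p)) s) → Family (rank xs) p
    basisFamily xs = family (proj₂ (basis xs))

    basis-independent : ∀ {s} (xs : Vec (Fin (q ^ p)) s) → Independent (basisFamily xs)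
    basis-independent []       _ _ ()
    basis-independent (x ∷ xs) with decode x ∈span? basisFamily xs
    ... | yes _      = basis-independent xs
    ... | no  x∉span = Independent-extend (family (x ∷ proj₂ (basis xs))) (basis-independent xs) x∉span

    basis-⊆ : ∀ {s} (xs : Vec (Fin (q ^ p)) s) i → ∃ λ j → lookup (proj₂ (basis xs)) i ≡ lookup xs j
    basis-⊆ (x ∷ xs) i with decode x ∈span? basisFamily xs
    basis-⊆ (x ∷ xs) i       | yes _ = let j , e = basis-⊆ xs i in suc j , e
    basis-⊆ (x ∷ xs) zero    | no  _ = zero , refl
    basis-⊆ (x ∷ xs) (suc i) | no  _ = let j , e = basis-⊆ xs i in suc j , e

    rank-∷ : ∀ {s} x (xs : Vec (Fin (q ^ p)) s) →
             (decode x ∈span basisFamily xs × rank (x ∷ xs) ≡ rank xs) ⊎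
             (¬ decode x ∈span basisFamily xs × rank (x ∷ xs) ≡ suc (rank xs))
    rank-∷ x xs with decode x ∈span? basisFamily xs
    ... | yes x∈span = inj₁ (x∈span , refl)
    ... | no  x∉span = inj₂ (x∉span , refl)

    ∈span-basis-atMost : ∀ {s r} (xs : Vec (Fin (q ^ p)) s) →
                         AtMost (q ^ r) (λ x → rank xs ≡ r × decode x ∈span basisFamily xs)
    ∈span-basis-atMost xs = AtMost-resize (cong (q ^_)) (∈span-atMost (basisFamily xs))

    ∉span-basis-atMost : ∀ {s r} (xs : Vec (Fin (q ^ p)) s) →
                         AtMost (q ^ p ∸ q ^ r) (λ x → rank xs ≡ r × ¬ decode x ∈span basisFamily xs)
    ∉span-basis-atMost xs = AtMost-resize (cong (λ k → q ^ p ∸ q ^ k)) (∉span-atMost (basis-independent xs))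

    rank-atMost : ∀ s r → AtMost (qBinom q s r * falling q p r) (λ (xs : Vec (Fin (q ^ p)) s) → rank xs ≡ r)
    rank-atMost zero    zero    = record { index = λ _ _ → zero ; index-injective = λ { [] [] _ _ _ → refl } }
    rank-atMost zero    (suc r) = record { index = λ { [] () } ; index-injective = λ { [] [] _ _ _ → refl } }
    rank-atMost (suc s) zero    = AtMost-mono split (AtMost-∷ (rank-atMost s zero) ∈span-basis-atMost)
      where
      split : ∀ xs → rank xs ≡ 0 → rank (tail xs) ≡ 0 × decode (head xs) ∈span basisFamily (tail xs)
      split (x ∷ xs) rank≡0 with rank-∷ x xs
      ... | inj₁ (x∈span , e) = trans (sym e) rank≡0 , x∈span
      ... | inj₂ (_ , e) with () ← trans (sym e) rank≡0
    -- x ∷ xs has rank r+1 iff either xs has rank r+1 and x is one of the q^(r+1) vectors in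
    -- its span, or xs has rank r and x is one of the q^p - q^r others: the q-Pascal rule.
    rank-atMost (suc s) (suc r) =
      subst (λ K → AtMost K (λ (xs : Vec (Fin (q ^ p)) (suc s)) → rank xs ≡ suc r))
            (pascal (qBinom q s (suc r)) (qBinom q s r) (falling q p r) (q ^ p ∸ q ^ r) (q ^ suc r))
            (AtMost-⊎ (AtMost-∷ (rank-atMost s (suc r)) ∈span-basis-atMost)
                      (AtMost-∷ (rank-atMost s r) ∉span-basis-atMost) split)
      where
      pascal : ∀ a b c d e → a * (c * d) * e + b * c * d ≡ (e * a + b) * (c * d)
      pascal = solve-∀
      split : ∀ xs → rank xs ≡ suc r →
              (rank (tail xs) ≡ suc r × decode (head xs) ∈span basisFamily (tail xs)) ⊎
              (rank (tail xs) ≡ r × ¬ decode (head xs) ∈span basisFamily (tail xs))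
      split (x ∷ xs) rank≡1+r with rank-∷ x xs
      ... | inj₁ (x∈span , e) = inj₁ (trans (sym e) rank≡1+r , x∈span)
      ... | inj₂ (x∉span , e) = inj₂ (ℕ.suc-injective (trans (sym e) rank≡1+r) , x∉span)

    rank≤-atMost : ∀ s u →
      AtMost (sumTo u (λ r → qBinom q s r * falling q p r)) (λ (xs : Vec (Fin (q ^ p)) s) → rank xs ≤ u)
    rank≤-atMost s zero    = AtMost-mono (λ _ → ℕ.n≤0⇒n≡0) (rank-atMost s zero)
    rank≤-atMost s (suc u) = AtMost-⊎ (rank≤-atMost s u) (rank-atMost s (suc u))
                                       (λ _ → Sum.map ℕ.≤-pred (λ e → e) ∘ ℕ.m≤n⇒m<n∨m≡n)

    columns : ∀ {s} → Mat F p s → Vec (Fin (q ^ p)) s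
    columns M = tabulate λ j → encode λ i → M i j

    family-columns : ∀ {s} (M : Mat F p s) j i → family (columns M) j i ≈ M i j
    family-columns M j i =
      ≈-trans (≈-reflexive (cong (λ x → decode x i) (Vec.lookup∘tabulate _ j))) (decode-encode (λ i → M i j) i)

    columns-injective : ∀ {s} {M N : Mat F p s} → columns M ≡ columns N → _≈M_ F M N
    columns-injective {M = M} {N} e i j = begin
      M i j                     ≈⟨ family-columns M j i ⟨
      family (columns M) j i    ≡⟨ cong (λ X → family X j i) e ⟩
      family (columns N) j i    ≈⟨ family-columns N j i ⟩
      N i j                     ∎
      where open ≈-Reasoning

    rank-columns≤ : ∀ {s u} (M : Mat F p s) → RankLE F u M → rank (columns M) ≤ u
    rank-columns≤ {u = u} M rank≤u = ℕ.≮⇒≥ λ u<rank →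
      let ρ , ind = Independent-sub u<rank (basis-independent (columns M))
          σ i     = proj₁ (basis-⊆ (columns M) (ρ i))
      in rank≤u (σ , Independent-cong (λ i r → ≈-trans
           (≈-reflexive (cong (λ x → decode x r) (proj₂ (basis-⊆ (columns M) (ρ i)))))
           (family-columns M (σ i) r)) ind)

    distinct-lowRank-bound : ∀ {s u N} (T : Fin N → Mat F p s) → (∀ k l → _≈M_ F (T k) (T l) → k ≡ l) →
      (∀ k → RankLE F u (T k)) → N ≤ sumTo u (λ r → qBinom q s r * falling q p r)
    distinct-lowRank-bound {s} {u} T T-distinct T-rank≤u =
      AtMost-bound (rank≤-atMost s u) (columns ∘ T) (λ k → rank-columns≤ (T k) (T-rank≤u k))
                   (λ e → T-distinct _ _ (columns-injective e))

  RankGE-reindexRows : ∀ {a a′ b k} (ι : Fin a′ → Fin a) (M : Mat F a b) →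
                       RankGE F k (λ i j → M (ι i) j) → RankGE F k M
  RankGE-reindexRows ι M (σ , ind) = σ , λ c c·M≈0 → ind c (c·M≈0 ∘ ι)

  RankGE-reindexCols : ∀ {a b b′ k} (ι : Fin b′ → Fin b) (M : Mat F a b) →
                       RankGE F k (λ i j → M i (ι j)) → RankGE F k M
  RankGE-reindexCols ι M (σ , ind) = ι ∘ σ , ind

  RankGE⇒≤rows : ∀ {a b k} (M : Mat F a b) → RankGE F k M → k ≤ a
  RankGE⇒≤rows M (σ , ind) = Independent⇒≤ {W = λ l r → M r (σ l)} ind

  RankGE⇒≤cols : ∀ {a b k} (M : Mat F a b) → RankGE F k M → k ≤ b
  RankGE⇒≤cols M (σ , ind) =
    Fin.injective⇒≤ λ σi≡σj → Independent-injective ind λ r → ≈-reflexive (cong (M r) σi≡σj)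

  RankGE-suc⇒nonzero : ∀ {a b k} {M : Mat F a b} → RankGE F (suc k) M → ¬ (∀ i j → M i j ≈ 0#)
  RankGE-suc⇒nonzero {M = M} (σ , ind) M≈0 =
    Independent-nonzero {W = λ l r → M r (σ l)} ind zero λ r → M≈0 r (σ zero)

  RankGE-removeCol : ∀ {a b k} (D : Mat F a (suc b)) c →
                     RankGE F (suc k) D → RankGE F k (λ i j → D i (punchIn c j))
  RankGE-removeCol {b = b} {k} D c (σ , ind) =
    σ′ , Independent-cong same-column (Independent-removeAt {W = W} ind l₀)
    where
    W : Family (suc k) _
    W l r = D r (σ l)
    -- drop the selected column that is c, if there is one
    l₀ : Fin (suc k)
    l₀ with Fin.any? (λ l → σ l Fin.≟ c)
    ... | yes (l , _) = l
    ... | no  _       = zero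
    avoids : ∀ i → c ≢ σ (punchIn l₀ i)
    avoids i c≡σ with Fin.any? (λ l → σ l Fin.≟ c)
    ... | yes (l , σl≡c) = Fin.punchInᵢ≢i l i
      (Independent-injective {W = W} ind λ r → ≈-reflexive (cong (D r) (trans (sym c≡σ) (sym σl≡c))))
    ... | no  ∄l         = ∄l (punchIn zero i , sym c≡σ)
    σ′ : Fin k → Fin b
    σ′ i = punchOut (avoids i)
    same-column : ∀ i r → D r (σ (punchIn l₀ i)) ≈ D r (punchIn c (σ′ i))
    same-column i r = ≈-reflexive (cong (D r) (sym (Fin.punchIn-punchOut (avoids i))))

  splitAt-view : ∀ m n (i : Fin (m + n)) → (∃ λ i′ → i′ ↑ˡ n ≡ i) ⊎ (∃ λ i′ → m ↑ʳ i′ ≡ i)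
  splitAt-view m n i with splitAt m i in eq
  ... | inj₁ i′ = inj₁ (i′ , trans (cong (join m n) (sym eq)) (Fin.join-splitAt m n i))
  ... | inj₂ i′ = inj₂ (i′ , trans (cong (join m n) (sym eq)) (Fin.join-splitAt m n i))

  RankGE-bottom : ∀ {m n b k} (D : Mat F (m + n) b) → (∀ i j → D (i ↑ˡ n) j ≈ 0#) →
                  RankGE F k D → RankGE F k (λ i j → D (m ↑ʳ i) j)
  RankGE-bottom {m} {n} D top≈0 (σ , ind) = σ , λ c c·bottom≈0 → ind c (all-rows c c·bottom≈0)
    where
    all-rows : ∀ c → (∀ i → lincomb c (λ l i → D (m ↑ʳ i) (σ l)) i ≈ 0#) →
               ∀ row → lincomb c (λ l i → D i (σ l)) row ≈ 0#
    all-rows c c·bottom≈0 row with splitAt-view m n row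
    ... | inj₁ (i , refl) = lincomb-zeroʳ c (λ l i → D i (σ l)) (λ l → top≈0 i (σ l))
    ... | inj₂ (i , refl) = c·bottom≈0 i

  RankGE-right : ∀ {a m n k} (D : Mat F a (m + n)) → (∀ i j → D i (j ↑ˡ n) ≈ 0#) →
                 RankGE F k D → RankGE F k (λ i j → D i (m ↑ʳ j))
  RankGE-right {m = m} {n} {k} D left≈0 (σ , ind) = proj₁ ∘ right , Independent-cong same-column ind
    where
    right : ∀ l → ∃ λ j → m ↑ʳ j ≡ σ l
    right l with splitAt-view m n (σ l)
    ... | inj₁ (j , e) = ⊥-elim (Independent-nonzero {W = λ l r → D r (σ l)} ind l λ r →
                           ≈-trans (≈-reflexive (cong (D r) (sym e))) (left≈0 r j))
    ... | inj₂ j,e     = j,e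
    same-column : ∀ l r → D r (σ l) ≈ D r (m ↑ʳ proj₁ (right l))
    same-column l r = ≈-reflexive (cong (D r) (sym (proj₂ (right l))))

  -- Two codewords agreeing on the top m rows differ by a matrix of rank at most n < d.
  code-bound-rows : ∀ {a b d u N} m n → m + n ≡ a → (𝒞 : Fin N → Mat F a b) → IsCode F a b d u N 𝒞 → n < d →
                    N ≤ sumTo u (λ r → qBinom q b r * falling q m r)
  code-bound-rows {N = N} m n refl 𝒞 (_ , distance , rank≤u) n<d =
    ColumnSpace.distinct-lowRank-bound m top top-distinct λ k → rank≤u k ∘ RankGE-reindexRows (_↑ˡ n) (𝒞 k)
    where
    top : Fin N → Mat F m _
    top k i j = 𝒞 k (i ↑ˡ n) j
    top-distinct : ∀ k l → _≈M_ F (top k) (top l) → k ≡ l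
    top-distinct k l top-k≈top-l with k Fin.≟ l
    ... | yes k≡l = k≡l
    ... | no  k≢l = ⊥-elim (ℕ.<⇒≱ n<d (RankGE⇒≤rows (λ i j → (_-M_ F (𝒞 k) (𝒞 l)) (m ↑ʳ i) j)
            (RankGE-bottom (_-M_ F (𝒞 k) (𝒞 l)) (λ i j → x≈y⇒x∙y⁻¹≈ε (top-k≈top-l i j)) (distance k l k≢l))))

  code-bound-cols : ∀ {a b d u N} m n → m + n ≡ b → (𝒞 : Fin N → Mat F a b) → IsCode F a b d u N 𝒞 → n < d →
                    N ≤ sumTo u (λ r → qBinom q m r * falling q a r)
  code-bound-cols {a} {N = N} m n refl 𝒞 (_ , distance , rank≤u) n<d =
    ColumnSpace.distinct-lowRank-bound a left left-distinct λ k → rank≤u k ∘ RankGE-reindexCols (_↑ˡ n) (𝒞 k)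
    where
    left : Fin N → Mat F a m
    left k i j = 𝒞 k i (j ↑ˡ n)
    left-distinct : ∀ k l → _≈M_ F (left k) (left l) → k ≡ l
    left-distinct k l left-k≈left-l with k Fin.≟ l
    ... | yes k≡l = k≡l
    ... | no  k≢l = ⊥-elim (ℕ.<⇒≱ n<d (RankGE⇒≤cols (λ i j → (_-M_ F (𝒞 k) (𝒞 l)) i (m ↑ʳ j))
            (RankGE-right (_-M_ F (𝒞 k) (𝒞 l)) (λ i j → x≈y⇒x∙y⁻¹≈ε (left-k≈left-l i j)) (distance k l k≢l))))

  puncture : ∀ {a b d u N} (𝒞 : Fin N → Mat F a (suc b)) → IsCode F a (suc b) (suc (suc d)) u N 𝒞 →
             IsCode F a b (suc d) u N (λ k i j → 𝒞 k i (suc j))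
  puncture 𝒞 (_ , distance , rank≤u) =
    distinct , distance′ , λ k → rank≤u k ∘ RankGE-reindexCols suc (𝒞 k)
    where
    distance′ = λ k l k≢l → RankGE-removeCol (_-M_ F (𝒞 k) (𝒞 l)) zero (distance k l k≢l)
    distinct : ∀ k l → _≈M_ F (λ i j → 𝒞 k i (suc j)) (λ i j → 𝒞 l i (suc j)) → k ≡ l
    distinct k l Ck≈Cl with k Fin.≟ l
    ... | yes k≡l = k≡l
    ... | no  k≢l = ⊥-elim (RankGE-suc⇒nonzero (distance′ k l k≢l) λ i j → x≈y⇒x∙y⁻¹≈ε (Ck≈Cl i j))

[c∸d+1]+[d∸1]≡c : ∀ {c d} → 1 ≤ d → d ≤ c → (c ∸ d + 1) + (d ∸ 1) ≡ c
[c∸d+1]+[d∸1]≡c {c} {d} 1≤d d≤c = begin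
  (c ∸ d + 1) + (d ∸ 1)   ≡⟨ ℕ.+-assoc (c ∸ d) 1 (d ∸ 1) ⟩
  (c ∸ d) + (1 + (d ∸ 1)) ≡⟨ cong ((c ∸ d) +_) (ℕ.m+[n∸m]≡n 1≤d) ⟩
  (c ∸ d) + d             ≡⟨ ℕ.m∸n+n≡m d≤c ⟩
  c                       ∎
  where open ≡-Reasoning

module _ {q : ℕ} (F : FiniteField q) where
  open LinearAlgebra F

  Λ-shortening : ∀ a b d u → ΛLe F a (suc b) (suc (suc d)) u a b (suc d) u
  Λ-shortening a b d u N 𝒞 code = N , _ , puncture 𝒞 code , ℕ.≤-refl

  Λ-bound : ∀ {a b d u} → 1 ≤ d → d ≤ a ⊓ b → ΛLeN F a b d u (boundΛ q u (a ⊓ b ∸ d + 1) (a ⊔ b))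
  Λ-bound {a} {b} {d} {u} 1≤d d≤a⊓b N 𝒞 code with ℕ.≤-total a b
  ... | inj₁ a≤b rewrite ℕ.m≤n⇒m⊓n≡m a≤b | ℕ.m≤n⇒m⊔n≡n a≤b =
    subst (N ≤_) (rankCount≡boundΛ 2≤q u (a ∸ d + 1) b)
          (code-bound-rows (a ∸ d + 1) (d ∸ 1) ([c∸d+1]+[d∸1]≡c 1≤d d≤a⊓b) 𝒞 code d∸1<d)
    where d∸1<d = ℕ.∸-monoʳ-< {d} {1} {0} (s≤s z≤n) 1≤d
  ... | inj₂ b≤a rewrite ℕ.m≥n⇒m⊓n≡n b≤a | ℕ.m≥n⇒m⊔n≡m b≤a =
    subst (N ≤_) (rankCount≡boundΛ-flip 2≤q u (b ∸ d + 1) a)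
          (code-bound-cols (b ∸ d + 1) (d ∸ 1) ([c∸d+1]+[d∸1]≡c 1≤d d≤a⊓b) 𝒞 code d∸1<d)
    where d∸1<d = ℕ.∸-monoʳ-< {d} {1} {0} (s≤s z≤n) 1≤d

theorem9 : (q : ℕ) → IsPrimePower q → (F : FiniteField q) →
    (a b d u : ℕ) → 2 ≤ d → d ≤ a ⊓ b →
    ΛLe F a b d u a (b ∸ 1) (d ∸ 1) u ×
    ΛLeN F a b d u
      (sumTo (u ⊓ (a ⊓ b ∸ d + 1)) (λ r →
        q ^ (r C 2) * (q ∸ 1) ^ r * qFact q r
          * gauss q (a ⊓ b ∸ d + 1) r * gauss q (a ⊔ b) r))
theorem9 q _ F a zero d u 2≤d d≤a⊓0 =
  ⊥-elim (ℕ.<⇒≱ (ℕ.≤-trans (s≤s z≤n) 2≤d) (ℕ.≤-trans d≤a⊓0 (ℕ.m⊓n≤n a 0)))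
theorem9 q _ F a (suc b) (suc (suc d)) u (s≤s (s≤s z≤n)) d≤a⊓b =
  Λ-shortening F a b d u , Λ-bound F (s≤s z≤n) d≤a⊓b
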